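{- For a CBI-model $M=\langle R,\circ,e,-,\infty\rangle$, let $[\![M]\!]=\langle R,\circ,\mathbin{ -\bullet},\{e\},x\mapsto\{ -x\},\{\infty\}\rangle$, where $X\mathbin{ -\bullet}Y=\{z\in R\mid\exists x\in X,y\in Y.\ y\in x\circ z\}$. Then $[\![M]\!]$ is a unitary $\mathrm{AX}_{\mathrm{CBI}}$-model, and the map $M\mapsto[\![M]\!]$ is a bijection between CBI-models and unitary $\mathrm{AX}_{\mathrm{CBI}}$-models.
   Context: A CBI-model is $\langle R,\circ,e,-,\infty\rangle$ with $e\in R$, $\circ:R\times R\to\mathcal{P}(R)$ commutative and associative (w.r.t. the pointwise extension $X\circ Y=\bigcup_{x\in X,y\in Y}x\circ y$) with $r\circ e=\{r\}$ for all $r$, $-:R\to R$, $\infty\in R$, such that for each $x$, $-x$ is the unique element with $\infty\in x\circ(-x)$. An $\mathrm{ML}_{\mathrm{CBI}}$ frame is a tuple $\langle R,\circ,\mathbin{ -\bullet},e,-,\infty\rangle$ with $\circ:R\times R\to\mathcal{P}(R)$, $\mathbin{ -\bullet}:\mathcal{P}(R)\times\mathcal{P}(R)\to\mathcal{P}(R)$, $e\subseteq R$, $-:R\to\mathcal{P}(R)$, $\infty\subseteq R$; $\circ$ and $-$ are extended pointwise to subsets. It is unitary if $e$ is a singleton. Modal formulas: $A ::= P\mid\top\mid\bot\mid\neg A\mid A\wedge A\mid A\vee A\mid A\to A\mid e\mid\infty\mid -A\mid A\circ A\mid A\mathbin{ -\bullet}A$. Given an environment $\rho$ mapping variables to subsets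 of $R$: additive connectives classically pointwise, $r\models_\rho P$ iff $r\in\rho(P)$; $r\models_\rho e$ iff $r\in e$; $r\models_\rho\infty$ iff $r\in\infty$; $r\models_\rho -A$ iff $\exists r'.\ r\in -r'$ and $r'\models_\rho A$; $r\models_\rho A_1\circ A_2$ iff $\exists r_1,r_2.\ r\in r_1\circ r_2$, $r_1\models_\rho A_1$, $r_2\models_\rho A_2$; $r\models_\rho A_1\mathbin{ -\bullet}A_2$ iff $\exists r_1,r_2.\ r\in\{r_1\}\mathbin{ -\bullet}\{r_2\}$, $r_1\models_\rho A_1$, $r_2\models_\rho A_2$. A formula is true in a frame if every point satisfies it under every environment. An $\mathrm{AX}_{\mathrm{CBI}}$-model is a frame in which the following are true (for propositional variables $P,Q,R$): (1) $e\circ P\to P$; (2) $P\to e\circ P$; (3) $P\circ Q\to Q\circ P$; (4) $(P\circ Q)\circ R\to P\circ(Q\circ R)$; (5) $P\circ(Q\circ R)\to(P\circ Q)\circ R$; (6) $Q\wedge(R\circ P)\to(R\wedge(P\mathbin{ -\bullet}Q))\circ\top$; (7) $R\wedge(P\mathbin{ -\bullet}Q)\to(\top\mathbin{ -\bullet}(Q\wedge(R\circ P)))$; (8) $--P\to P$; (9) $P\to --P$; (10) $-P\to(P\mathbin{ -\bullet}\infty)$; (11) $(P\mathbin{ -\bullet}\infty)\to -P$. (Unitary $\mathrm{AX}_{\mathrm{CBI}}$-models are identified with CBI-models by regarding the singleton sets $e$, $\infty$, $-x$ as elements.)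
   Formalization: In an $\mathrm{ML}_{\mathrm{CBI}}$ frame, −• is given only on pairs of points, as the sets {r₁} −• {r₂}, and extended pointwise to subsets, rather than as an arbitrary map $\mathcal{P}(R)\times\mathcal{P}(R)\to\mathcal{P}(R)$. The statement above fails without it. -}

module Defs where

open import Level using (Level; suc; zero)
open import Data.Nat using (ℕ)
open import Data.Product using (Σ; Σ-syntax; ∃; ∃-syntax; _×_; _,_)
open import Data.Sum using (_⊎_)
open import Data.Unit using (⊤)
open import Data.Empty using (⊥)
open import Relation.Nullary using (¬_)
open import Relation.Binary.PropositionalEquality using (_≡_)
open import Function.Bundles using (_⇔_)

Pow : Set → Set₁
Pow R = R → Set

_≐_ : {R : Set} → Pow R → Pow R → Set
X ≐ Y = ∀ z → X z ⇔ Y z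

record CBIModel (R : Set) : Set₁ where
  field
    _∘_  : R → R → Pow R
    e    : R
    -_   : R → R
    ∞    : R

  -- pointwise extension: (x ∘ y) ∘ z  and  x ∘ (y ∘ z)
  _∘ˡ_ : Pow R → R → Pow R
  (X ∘ˡ z) w = Σ[ u ∈ R ] (X u × (u ∘ z) w)

  _∘ʳ_ : R → Pow R → Pow R
  (x ∘ʳ Y) w = Σ[ v ∈ R ] (Y v × (x ∘ v) w)

  field
    comm    : ∀ x y → (x ∘ y) ≐ (y ∘ x)
    assoc   : ∀ x y z → ((x ∘ y) ∘ˡ z) ≐ (x ∘ʳ (y ∘ z))
    unit    : ∀ r → (r ∘ e) ≐ (λ w → w ≡ r)
    inv     : ∀ x → (x ∘ (- x)) ∞
    inv-uniq : ∀ x y → (x ∘ y) ∞ → y ≡ - x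

record _≅CBI_ {R : Set} (M M' : CBIModel R) : Set where
  private
    module M  = CBIModel M
    module M' = CBIModel M'
  field
    ∘-eq : ∀ x y → (M._∘_ x y) ≐ (M'._∘_ x y)
    e-eq : M.e ≡ M'.e
    neg-eq : ∀ x → M.-_ x ≡ M'.-_ x
    ∞-eq : M.∞ ≡ M'.∞

-- ML_CBI frames
-- ∘ and − are given on points and extended pointwise to subsets; −• is
-- given on pairs of points ({r1} −• {r2}) and extended pointwise
-- (only singleton values of −• are used by the semantics).

record Frame (R : Set) : Set₁ where
  field
    _∘_  : R → R → Pow R
    _-•_ : R → R → Pow R
    e    : Pow R
    -_   : R → Pow R
    ∞    : Pow R

record _≅F_ {R : Set} (F F' : Frame R) : Set where
  private
    module F  = Frame F
    module F' = Frame F'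
  field
    ∘-eq  : ∀ x y → (F._∘_ x y) ≐ (F'._∘_ x y)
    -•-eq : ∀ x y → (F._-•_ x y) ≐ (F'._-•_ x y)
    e-eq  : F.e ≐ F'.e
    neg-eq  : ∀ x → (F.-_ x) ≐ (F'.-_ x)
    ∞-eq  : F.∞ ≐ F'.∞

IsSingleton : {R : Set} → Pow R → Set
IsSingleton {R} X = Σ[ x ∈ R ] (X ≐ (λ w → w ≡ x))

Unitary : {R : Set} → Frame R → Set
Unitary F = IsSingleton (Frame.e F)

infixr 4 _⇒_
infixr 5 _∨_
infixr 6 _∧_
infixr 7 _∘f_ _-•f_

data Form : Set where
  var  : ℕ → Form
  ⊤f   : Form
  ⊥f   : Form
  ¬f_  : Form → Form
  _∧_  : Form → Form → Form
  _∨_  : Form → Form → Form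
  _⇒_  : Form → Form → Form
  ef   : Form
  ∞f   : Form
  -f_  : Form → Form
  _∘f_ : Form → Form → Form
  _-•f_ : Form → Form → Form

Env : Set → Set₁
Env R = ℕ → Pow R

Sat : {R : Set} → Frame R → Env R → R → Form → Set
Sat F ρ r (var n)   = ρ n r
Sat F ρ r ⊤f        = ⊤
Sat F ρ r ⊥f        = ⊥
Sat F ρ r (¬f A)    = ¬ Sat F ρ r A
Sat F ρ r (A ∧ B)   = Sat F ρ r A × Sat F ρ r B
Sat F ρ r (A ∨ B)   = Sat F ρ r A ⊎ Sat F ρ r B
Sat F ρ r (A ⇒ B)   = Sat F ρ r A → Sat F ρ r B
Sat F ρ r ef        = Frame.e F r
Sat F ρ r ∞f        = Frame.∞ F r
Sat {R} F ρ r (-f A) = Σ[ r' ∈ R ] (Frame.-_ F r' r × Sat F ρ r' A)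
Sat {R} F ρ r (A ∘f B) =
  Σ[ r₁ ∈ R ] Σ[ r₂ ∈ R ] (Frame._∘_ F r₁ r₂ r × Sat F ρ r₁ A × Sat F ρ r₂ B)
Sat {R} F ρ r (A -•f B) =
  Σ[ r₁ ∈ R ] Σ[ r₂ ∈ R ] (Frame._-•_ F r₁ r₂ r × Sat F ρ r₁ A × Sat F ρ r₂ B)

TrueIn : {R : Set} → Frame R → Form → Set₁
TrueIn {R} F A = (ρ : Env R) (r : R) → Sat F ρ r A

P Q Rv : Form
P  = var 0
Q  = var 1
Rv = var 2

record IsAXCBIModel {R : Set} (F : Frame R) : Set₁ where
  field
    ax1  : TrueIn F (ef ∘f P ⇒ P)
    ax2  : TrueIn F (P ⇒ ef ∘f P)
    ax3  : TrueIn F (P ∘f Q ⇒ Q ∘f P)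
    ax4  : TrueIn F ((P ∘f Q) ∘f Rv ⇒ P ∘f (Q ∘f Rv))
    ax5  : TrueIn F (P ∘f (Q ∘f Rv) ⇒ (P ∘f Q) ∘f Rv)
    ax6  : TrueIn F (Q ∧ (Rv ∘f P) ⇒ (Rv ∧ (P -•f Q)) ∘f ⊤f)
    ax7  : TrueIn F (Rv ∧ (P -•f Q) ⇒ (⊤f -•f (Q ∧ (Rv ∘f P))))
    ax8  : TrueIn F (-f (-f P) ⇒ P)
    ax9  : TrueIn F (P ⇒ -f (-f P))
    ax10 : TrueIn F (-f P ⇒ (P -•f ∞f))
    ax11 : TrueIn F ((P -•f ∞f) ⇒ -f P)

IsUnitaryAXCBIModel : {R : Set} → Frame R → Set₁
IsUnitaryAXCBIModel F = IsAXCBIModel F × Unitary F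

⟦_⟧ : {R : Set} → CBIModel R → Frame R
⟦_⟧ {R} M = record
  { _∘_  = M._∘_
  ; _-•_ = λ x y z → (M._∘_ x z) y      -- {x} −• {y} = {z | y ∈ x ∘ z}
  ; e    = λ w → w ≡ M.e
  ; -_   = λ x w → w ≡ M.-_ x
  ; ∞    = λ w → w ≡ M.∞
  }
  where module M = CBIModel M

module Submission where

open import Defs
open import Data.Product using (Σ; Σ-syntax; _×_; _,_; proj₁; proj₂)
open import Data.Nat using (zero; suc)
open import Data.Unit using (tt)
open import Function.Bundles using (_⇔_; mk⇔; Equivalence)
open import Relation.Binary.PropositionalEquality using (_≡_; refl; sym; subst)

-- Soundness: each axiom of AX_CBI, read in ⟦ M ⟧, is one of the CBI-model
-- laws (unit, commutativity, associativity, the definition of −• as the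
-- residual of ∘, and the characterisation of −x through ∞ ∈ x ∘ y),
-- together with the derived law − − x = x.
--
-- Injectivity: ⟦ M ⟧ keeps ∘ and the singletons {e}, {−x}, {∞}, so
-- equal frames have equal CBI-structure.
--
-- Surjectivity: evaluating an axiom under an environment that sends
-- P, Q, R to singletons turns it into a first-order condition on the
-- frame (the Sahlqvist correspondents). In any AX_CBI-model this makes ∘
-- commutative and associative, −• the residual of ∘, and −x exactly the
-- set of y with x ∘ y meeting ∞, which is a singleton. Unitarity then
-- makes e a two-sided unit and ∞ a singleton, so the frame is ⟦ M ⟧ for
-- the CBI-model M read off from it.

open Equivalence using (to; from)

⟨_⟩ : {R : Set} → R → Pow R
⟨ x ⟩ w = w ≡ x

points : {R : Set} → R → R → R → Env R
points x y z zero          = ⟨ x ⟩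
points x y z (suc zero)    = ⟨ y ⟩
points x y z (suc (suc _)) = ⟨ z ⟩

module Soundness {R : Set} (M : CBIModel R) where
  open CBIModel M

  -- Since ∞ ∈ x ∘ (− x) = (− x) ∘ x, uniqueness of inverses gives − − x = x.
  neg-involutive : ∀ x → - (- x) ≡ x
  neg-involutive x = sym (inv-uniq (- x) x (to (comm x (- x) ∞) (inv x)))

  unitˡ : ∀ {r w} → (e ∘ r) w → w ≡ r
  unitˡ {r} {w} h = to (unit r w) (to (comm e r w) h)

  ⟦⟧-isAX : IsAXCBIModel ⟦ M ⟧
  ⟦⟧-isAX = record
    { ax1  = λ { ρ r (_ , r₂ , h , refl , p) → subst (ρ 0) (sym (unitˡ h)) p }
    ; ax2  = λ ρ r p → e , r , to (comm r e r) (from (unit r r) refl) , refl , p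
    ; ax3  = λ { ρ r (r₁ , r₂ , h , p , q) → r₂ , r₁ , to (comm r₁ r₂ r) h , q , p }
    ; ax4  = λ { ρ r (r₁ , r₂ , h , (s₁ , s₂ , h′ , p , q) , t) →
               let (v , hv , hr) = to (assoc s₁ s₂ r₂ r) (r₁ , h′ , h)
               in s₁ , v , hr , p , (s₂ , r₂ , hv , q , t) }
    ; ax5  = λ { ρ r (r₁ , r₂ , h , p , (s₁ , s₂ , h′ , q , t)) →
               let (u , hu , hr) = from (assoc r₁ s₁ s₂ r) (r₂ , h′ , h)
               in u , s₂ , hr , (r₁ , s₁ , hu , p , q) , t }
    ; ax6  = λ { ρ r (q , (r₁ , r₂ , h , x , p)) →
               r₁ , r₂ , h , (x , (r₂ , r , to (comm r₁ r₂ r) h , p , q)) , tt }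
    ; ax7  = λ { ρ r (x , (p′ , q′ , h , p , q)) →
               p′ , q′ , h , tt , (q , r , p′ , to (comm p′ r q′) h , x , p) }
    ; ax8  = λ { ρ r (_ , refl , (r″ , refl , p)) → subst (ρ 0) (sym (neg-involutive r″)) p }
    ; ax9  = λ ρ r p → - r , sym (neg-involutive r) , (r , refl , p)
    ; ax10 = λ { ρ r (r′ , refl , p) → r′ , ∞ , inv r′ , p , refl }
    ; ax11 = λ { ρ r (p′ , _ , h , p , refl) → p′ , inv-uniq p′ r h , p }
    }

  ⟦⟧-unitary-AX : IsUnitaryAXCBIModel ⟦ M ⟧
  ⟦⟧-unitary-AX = ⟦⟧-isAX , (e , λ z → mk⇔ (λ x → x) (λ x → x))

⟦⟧-injective : {R : Set} (M M′ : CBIModel R) → ⟦ M ⟧ ≅F ⟦ M′ ⟧ → M ≅CBI M′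
⟦⟧-injective M M′ iso = record
  { ∘-eq   = ∘-eq
  ; e-eq   = to (e-eq (CBIModel.e M)) refl
  ; neg-eq = λ x → to (neg-eq x (CBIModel.-_ M x)) refl
  ; ∞-eq   = to (∞-eq (CBIModel.∞ M)) refl
  }
  where open _≅F_ iso

module Correspondents {R : Set} (F : Frame R) (ax : IsAXCBIModel F) where
  open Frame F
  open IsAXCBIModel ax

  ∘-comm : ∀ {x y z} → (x ∘ y) z → (y ∘ x) z
  ∘-comm {x} {y} {z} h with ax3 (points x y y) z (x , y , h , refl , refl)
  ... | (_ , _ , h′ , refl , refl) = h′

  ∘-assocʳ : ∀ {x y z w} → Σ[ u ∈ R ] ((x ∘ y) u × (u ∘ z) w)
           → Σ[ v ∈ R ] ((y ∘ z) v × (x ∘ v) w)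
  ∘-assocʳ {x} {y} {z} {w} (u , hu , h)
    with ax4 (points x y z) w (u , z , h , (x , y , hu , refl , refl) , refl)
  ... | (_ , v , h′ , refl , (_ , _ , hv , refl , refl)) = v , hv , h′

  ∘-assocˡ : ∀ {x y z w} → Σ[ v ∈ R ] ((y ∘ z) v × (x ∘ v) w)
           → Σ[ u ∈ R ] ((x ∘ y) u × (u ∘ z) w)
  ∘-assocˡ {x} {y} {z} {w} (v , hv , h)
    with ax5 (points x y z) w (x , v , h , refl , (y , z , hv , refl , refl))
  ... | (u , _ , h′ , (_ , _ , hu , refl , refl) , refl) = u , hu , h′

  residual-intro : ∀ {x y z} → (x ∘ y) z → (y -• z) x
  residual-intro {x} {y} {z} h
    with ax6 (points y z x) z (refl , (x , y , h , refl , refl))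
  ... | (_ , _ , _ , (refl , (_ , _ , h′ , refl , refl)) , _) = h′

  residual-elim : ∀ {x y z} → (y -• z) x → (x ∘ y) z
  residual-elim {x} {y} {z} h
    with ax7 (points y z x) x (refl , (y , z , h , refl , refl))
  ... | (_ , _ , _ , _ , (refl , (_ , _ , h′ , refl , refl))) = h′

  neg-exists : ∀ x → Σ[ a ∈ R ] (- x) a
  neg-exists x with ax9 (points x x x) x refl
  ... | (a , _ , (_ , ha , refl)) = a , ha

  neg⇒∞ : ∀ {x a} → (- x) a → Σ[ i ∈ R ] (∞ i × (x ∘ a) i)
  neg⇒∞ {x} {a} h with ax10 (points x x x) a (x , h , refl)
  ... | (_ , i , h′ , refl , fi) = i , fi , ∘-comm (residual-elim h′)

  ∞⇒neg : ∀ {x a i} → ∞ i → (x ∘ a) i → (- x) a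
  ∞⇒neg {x} {a} {i} fi h
    with ax11 (points x x x) a (x , i , residual-intro (∘-comm h) , refl , fi)
  ... | (_ , h′ , refl) = h′

  -- (8): − x is a singleton: if a, b ∈ − x then x ∈ − a, so b ∈ − − {a} ⊆ {a}.
  neg-unique : ∀ {x a b} → (- x) a → (- x) b → b ≡ a
  neg-unique {x} {a} {b} ha hb with neg⇒∞ ha
  ... | (i , fi , h) = ax8 (points a a a) b (x , hb , (a , ∞⇒neg fi (∘-comm h) , refl))

module Recovery {R : Set} (F : Frame R) (ax : IsAXCBIModel F) (un : Unitary F) where
  open Frame F
  open IsAXCBIModel ax
  open Correspondents F ax

  ε : R
  ε = proj₁ un

  e≐⟨ε⟩ : e ≐ ⟨ ε ⟩
  e≐⟨ε⟩ = proj₂ un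

  ε-unitˡ : ∀ r → (ε ∘ r) r
  ε-unitˡ r with ax2 (points r r r) r refl
  ... | (ε′ , _ , h , hε′ , refl) with to (e≐⟨ε⟩ ε′) hε′
  ... | refl = h

  ε-unitʳ-unique : ∀ {r w} → (r ∘ ε) w → w ≡ r
  ε-unitʳ-unique {r} {w} h =
    ax1 (points r r r) w (ε , r , ∘-comm h , from (e≐⟨ε⟩ ε) refl , refl)

  -- ∞ is inhabited: ε ∘ (− ε) meets it.
  ∞-exists : Σ[ i ∈ R ] ∞ i
  ∞-exists with neg⇒∞ (proj₂ (neg-exists ε))
  ... | (i , fi , _) = i , fi

  -- ∞ is a singleton: for i, j ∈ ∞ we get j ∈ − ε and ε ∈ − i, so j ∈ − − {i}.
  ∞-unique : ∀ {i j} → ∞ i → ∞ j → j ≡ i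
  ∞-unique {i} {j} fi fj =
    ax8 (points i i i) j (ε , ∞⇒neg fj (ε-unitˡ j) , (i , ∞⇒neg fi (∘-comm (ε-unitˡ i)) , refl))

  neg : R → R
  neg x = proj₁ (neg-exists x)

  inf : R
  inf = proj₁ ∞-exists

  neg-inverse : ∀ x → (x ∘ neg x) inf
  neg-inverse x with neg⇒∞ (proj₂ (neg-exists x))
  ... | (i , fi , h) = subst (x ∘ neg x) (∞-unique (proj₂ ∞-exists) fi) h

  model : CBIModel R
  model = record
    { _∘_      = _∘_
    ; e        = ε
    ; -_       = neg
    ; ∞        = inf
    ; comm     = λ x y z → mk⇔ ∘-comm ∘-comm
    ; assoc    = λ x y z w → mk⇔ ∘-assocʳ ∘-assocˡ
    ; unit     = λ r w → mk⇔ ε-unitʳ-unique (λ { refl → ∘-comm (ε-unitˡ r) })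
    ; inv      = neg-inverse
    ; inv-uniq = λ x y h → neg-unique (proj₂ (neg-exists x)) (∞⇒neg (proj₂ ∞-exists) h)
    }

  -- Its frame is F again; −• agrees with F's by residuation.
  model-iso : ⟦ model ⟧ ≅F F
  model-iso = record
    { ∘-eq   = λ x y z → mk⇔ (λ h → h) (λ h → h)
    ; -•-eq  = λ x y z → mk⇔ (λ h → residual-intro (∘-comm h)) (λ h → ∘-comm (residual-elim h))
    ; e-eq   = λ z → mk⇔ (from (e≐⟨ε⟩ z)) (to (e≐⟨ε⟩ z))
    ; neg-eq = λ x z → mk⇔ (λ { refl → proj₂ (neg-exists x) }) (neg-unique (proj₂ (neg-exists x)))
    ; ∞-eq   = λ z → mk⇔ (λ { refl → proj₂ ∞-exists }) (∞-unique (proj₂ ∞-exists))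
    }

lemma4p2p4 : (R : Set) →
    ((M : CBIModel R) → IsUnitaryAXCBIModel (⟦ M ⟧))
    × ((M M' : CBIModel R) → ⟦ M ⟧ ≅F ⟦ M' ⟧ → M ≅CBI M')
    × ((F : Frame R) → IsUnitaryAXCBIModel F → Σ[ M ∈ CBIModel R ] (⟦ M ⟧ ≅F F))
lemma4p2p4 R = Soundness.⟦⟧-unitary-AX , ⟦⟧-injective , recover
  where
  recover : (F : Frame R) → IsUnitaryAXCBIModel F → Σ[ M ∈ CBIModel R ] (⟦ M ⟧ ≅F F)
  recover F (ax , un) = Recovery.model F ax un , Recovery.model-iso F ax un
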